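{- Let $C\ge 3$ be a constant such that every finite linear hypergraph with no edges of rank $1$, maximum rank $P\ge C$ and maximum degree $\Delta\ge C(P-1)$ satisfies $q\le \Delta(P-1)-1$. Let $H$ be a finite linear hypergraph with $n$ vertices, no edges of rank $1$, maximum rank $P\ge C$ and maximum degree $\Delta\ge C(P-1)$. If $H$ is uniform or $n\ge \Delta(P-1)-1$, then $q(H)\le n$.
   Context: A hypergraph $H=(V,E)$ is a finite set $V$ with a set $E$ of subsets of $V$ (edges). The rank of an edge is its cardinality; the degree of a vertex is the number of edges containing it. $H$ is uniform if all edges have the same rank, and linear if any two distinct edges share at most one vertex. An edge coloring of $H$ is a map $\gamma:E\to\Gamma$ such that $\gamma(e)=\gamma(f)$ for distinct edges $e,f$ only if $e\cap f=\emptyset$; the chromatic index $q(H)$ is the minimum $|\Gamma|$ over all edge colorings. -}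

module Defs where

open import Data.Nat using (ℕ; _≤_; _∸_; _*_)
open import Data.Fin using (Fin)
open import Data.Fin.Subset using (Subset; ∣_∣; _∩_; Empty)
open import Data.Vec using (lookup; tabulate)
open import Data.Product using (Σ; ∃; _×_)
open import Relation.Binary.PropositionalEquality using (_≡_; _≢_)
open import Function.Definitions using (Injective)

-- A finite hypergraph: vertex set V = Fin nV, edge set given by an
-- injective family of subsets of V indexed by Fin nE (so E is a *set*
-- of subsets, with nE = |E|).
record Hypergraph : Set where
  field
    nV   : ℕ
    nE   : ℕ
    edge : Fin nE → Subset nV
    edge-inj : Injective _≡_ _≡_ edge
open Hypergraph public

rank : (H : Hypergraph) → Fin (nE H) → ℕ
rank H e = ∣ edge H e ∣

degree : (H : Hypergraph) → Fin (nV H) → ℕ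
degree H v = ∣ tabulate (λ e → lookup (edge H e) v) ∣

Uniform : Hypergraph → Set
Uniform H = ∀ e f → rank H e ≡ rank H f

Linear : Hypergraph → Set
Linear H = ∀ e f → e ≢ f → ∣ edge H e ∩ edge H f ∣ ≤ 1

NoRankOne : Hypergraph → Set
NoRankOne H = ∀ e → rank H e ≢ 1

MaxRank : Hypergraph → ℕ → Set
MaxRank H P = (∀ e → rank H e ≤ P) × ∃ (λ e → rank H e ≡ P)

MaxDegree : Hypergraph → ℕ → Set
MaxDegree H Δ = (∀ v → degree H v ≤ Δ) × ∃ (λ v → degree H v ≡ Δ)

IsEdgeColoring : (H : Hypergraph) (k : ℕ) → (Fin (nE H) → Fin k) → Set
IsEdgeColoring H k γ = ∀ e f → e ≢ f → γ e ≡ γ f → Empty (edge H e ∩ edge H f)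

-- q(H) ≤ k : the minimum number of colours of an edge coloring is at most k,
-- i.e. there is an edge coloring using (at most) k colours.
ChromaticIndex≤ : Hypergraph → ℕ → Set
ChromaticIndex≤ H k = Σ (Fin (nE H) → Fin k) (IsEdgeColoring H k)

-- Given the assumed bound, it suffices to show Δ(P−1)−1 ≤ n, since a
-- colouring with fewer colours is also one with n colours.  When
-- Δ(P−1)−1 ≤ n is assumed there is nothing to do; in the uniform case it
-- is a counting fact about linear hypergraphs: the edges through a vertex
-- v pairwise meet only in v, so for every vertex
--     Σ_{e ∋ v} |e|  ≤  deg v + (n − 1),                         (star bound)
-- and if all edges have rank P this reads deg v · (P−1) ≤ n − 1.
--
-- The star bound is proved by double counting the pairs (e, w) with
-- v, w ∈ e: the column w = v contributes deg v, and by linearity every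
-- other column w contributes at most 1.  The file first develops finite
-- sums of natural numbers (on top of the library's Σ over Fin), then
-- incidence counts in hypergraphs, then the star bound, and finally the
-- corollary.
module Submission where

open import Defs
open import Data.Nat using (ℕ; zero; suc; _+_; _*_; _∸_; _≤_; z≤n)
open import Data.Nat.Properties
  using (≤-trans; ≤-reflexive; +-mono-≤; +-monoʳ-≤; m≤m+n; m∸n≤m; m≤n+o⇒m∸n≤o;
         *-distribˡ-∸; *-identityˡ; *-identityʳ; <⇒≱; +-*-semiring; module ≤-Reasoning)
open import Algebra.Properties.Semiring.Sum +-*-semiring
  using (sum; sum-syntax; sum-remove; sum-cong-≗; ∑-comm;
         *-distribˡ-sum; *-distribʳ-sum)
open import Data.Bool using (Bool; true; false; _∧_)
open import Data.Fin using (Fin; zero; suc; inject≤; punchIn; punchOut)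
open import Data.Fin.Properties
  using (inject≤-injective; punchInᵢ≢i; punchIn-punchOut; _≟_; 0≢1+n; suc-injective)
open import Data.Bool.Properties using (∧-conicalˡ; ∧-conicalʳ)
open import Data.Fin.Subset using (Subset; ∣_∣; _∩_)
open import Data.Vec using ([]; _∷_; lookup; tabulate)
open import Data.Vec.Properties using (lookup∘tabulate; lookup-zipWith)
open import Data.Vec.Functional using (removeAt)
open import Data.Product using (∃; _,_; proj₂)
open import Data.Sum using (_⊎_; [_,_])
open import Data.Empty using (⊥-elim)
open import Function using (id)
open import Relation.Nullary using (yes; no)
open import Relation.Binary.PropositionalEquality
  using (_≡_; _≢_; refl; sym; trans; cong; cong₂; module ≡-Reasoning)

term≤sum : ∀ {n} (t : Fin n → ℕ) i → t i ≤ sum t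
term≤sum {suc n} t i =
  ≤-trans (m≤m+n (t i) (sum (removeAt t i))) (≤-reflexive (sym (sum-remove {i = i} t)))

two-terms≤sum : ∀ {n} (t : Fin n → ℕ) {i j} → i ≢ j → t i + t j ≤ sum t
two-terms≤sum {suc n} t {i} {j} i≢j = begin
  t i + t j                         ≡⟨ cong (λ k → t i + t k) (sym (punchIn-punchOut i≢j)) ⟩
  t i + removeAt t i (punchOut i≢j) ≤⟨ +-monoʳ-≤ (t i) (term≤sum (removeAt t i) (punchOut i≢j)) ⟩
  t i + sum (removeAt t i)          ≡⟨ sym (sum-remove {i = i} t) ⟩
  sum t                             ∎
  where open ≤-Reasoning

sum≤length : ∀ {n} (t : Fin n → ℕ) → (∀ i → t i ≤ 1) → sum t ≤ n
sum≤length {zero}  t t≤1 = z≤n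
sum≤length {suc n} t t≤1 = +-mono-≤ (t≤1 zero) (sum≤length (λ i → t (suc i)) (λ i → t≤1 (suc i)))

sum≤term+rest : ∀ {n} (t : Fin n → ℕ) i → (∀ j → j ≢ i → t j ≤ 1) → sum t ≤ t i + (n ∸ 1)
sum≤term+rest {suc n} t i others≤1 = begin
  sum t                    ≡⟨ sum-remove {i = i} t ⟩
  t i + sum (removeAt t i) ≤⟨ +-monoʳ-≤ (t i) (sum≤length (removeAt t i)
                                (λ j → others≤1 (punchIn i j) (punchInᵢ≢i i j))) ⟩
  t i + n                  ∎
  where open ≤-Reasoning

χ : Bool → ℕ
χ true  = 1
χ false = 0

χ-∧ : ∀ a b → χ (a ∧ b) ≡ χ a * χ b
χ-∧ true  b = sym (*-identityˡ (χ b))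
χ-∧ false b = refl

χ-idem : ∀ a → χ a * χ a ≡ χ a
χ-idem true  = refl
χ-idem false = refl

∣p∣≡∑χ : ∀ {n} (p : Subset n) → ∣ p ∣ ≡ ∑[ i < n ] χ (lookup p i)
∣p∣≡∑χ []          = refl
∣p∣≡∑χ (true ∷ p)  = cong suc (∣p∣≡∑χ p)
∣p∣≡∑χ (false ∷ p) = ∣p∣≡∑χ p

count-none : ∀ {n} (g : Fin n → Bool) → (∀ i → g i ≢ true) → ∑[ i < n ] χ (g i) ≡ 0
count-none {zero}  g none = refl
count-none {suc n} g none with g zero in g₀
... | true  = ⊥-elim (none zero g₀)
... | false = count-none (λ i → g (suc i)) (λ i → none (suc i))

count≤1 : ∀ {n} (g : Fin n → Bool) → (∀ i j → g i ≡ true → g j ≡ true → i ≡ j)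
        → ∑[ i < n ] χ (g i) ≤ 1
count≤1 {zero}  g unique = z≤n
count≤1 {suc n} g unique with g zero in g₀
... | true  = ≤-reflexive (cong suc (count-none (λ i → g (suc i))
                (λ i gᵢ → 0≢1+n (unique zero (suc i) g₀ gᵢ))))
... | false = count≤1 (λ i → g (suc i))
                (λ i j gᵢ gⱼ → suc-injective (unique (suc i) (suc j) gᵢ gⱼ))

incident : (H : Hypergraph) → Fin (nE H) → Fin (nV H) → Bool
incident H e v = lookup (edge H e) v

rank≡∑ : (H : Hypergraph) (e : Fin (nE H)) → rank H e ≡ ∑[ w < nV H ] χ (incident H e w)
rank≡∑ H e = ∣p∣≡∑χ (edge H e)

degree≡∑ : (H : Hypergraph) (v : Fin (nV H)) → degree H v ≡ ∑[ e < nE H ] χ (incident H e v)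
degree≡∑ H v = trans (∣p∣≡∑χ (tabulate (λ e → incident H e v)))
  (sum-cong-≗ (λ e → cong χ (lookup∘tabulate (λ f → incident H f v) e)))

common-edge-unique : (H : Hypergraph) → Linear H → ∀ {v w} → v ≢ w → ∀ e f
  → incident H e v ≡ true → incident H e w ≡ true
  → incident H f v ≡ true → incident H f w ≡ true → e ≡ f
common-edge-unique H lin {v} {w} v≢w e f ev ew fv fw with e ≟ f
... | yes e≡f = e≡f
... | no  e≢f = ⊥-elim (<⇒≱ two≤∣e∩f∣ (lin e f e≢f))
  where
  in-both : ∀ u → incident H e u ≡ true → incident H f u ≡ true
          → χ (lookup (edge H e ∩ edge H f) u) ≡ 1
  in-both u eu fu = cong χ (trans (lookup-zipWith _∧_ u (edge H e) (edge H f)) (cong₂ _∧_ eu fu))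
  open ≤-Reasoning
  two≤∣e∩f∣ : 2 ≤ ∣ edge H e ∩ edge H f ∣
  two≤∣e∩f∣ = begin
    1 + 1                          ≡⟨ sym (cong₂ _+_ (in-both v ev fv) (in-both w ew fw)) ⟩
    χ (lookup (edge H e ∩ edge H f) v) + χ (lookup (edge H e ∩ edge H f) w)
                                   ≤⟨ two-terms≤sum (λ u → χ (lookup (edge H e ∩ edge H f) u)) v≢w ⟩
    ∑[ u < nV H ] χ (lookup (edge H e ∩ edge H f) u)
                                   ≡⟨ sym (∣p∣≡∑χ (edge H e ∩ edge H f)) ⟩
    ∣ edge H e ∩ edge H f ∣        ∎

-- Double
-- count the pairs (e, w) with v, w ∈ e column by column.
star-bound : (H : Hypergraph) → Linear H → (v : Fin (nV H))
  → ∑[ e < nE H ] (χ (incident H e v) * rank H e) ≤ degree H v + (nV H ∸ 1)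
star-bound H lin v = begin
  ∑[ e < nE H ] (χ (incident H e v) * rank H e)
    ≡⟨ sum-cong-≗ (λ e → cong (χ (incident H e v) *_) (rank≡∑ H e)) ⟩
  ∑[ e < nE H ] (χ (incident H e v) * ∑[ w < nV H ] χ (incident H e w))
    ≡⟨ sum-cong-≗ (λ e → *-distribˡ-sum (χ (incident H e v)) (λ w → χ (incident H e w))) ⟩
  ∑[ e < nE H ] ∑[ w < nV H ] pair e w
    ≡⟨ ∑-comm pair ⟩
  ∑[ w < nV H ] column w
    ≤⟨ sum≤term+rest column v column≤1 ⟩
  column v + (nV H ∸ 1)
    ≡⟨ cong (_+ (nV H ∸ 1)) column-v ⟩
  degree H v + (nV H ∸ 1) ∎
  where
  open ≤-Reasoning
  pair : Fin (nE H) → Fin (nV H) → ℕ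
  pair e w = χ (incident H e v) * χ (incident H e w)
  column : Fin (nV H) → ℕ
  column w = ∑[ e < nE H ] pair e w
  column-v : column v ≡ degree H v
  column-v = trans (sum-cong-≗ (λ e → χ-idem (incident H e v))) (sym (degree≡∑ H v))
  column≤1 : ∀ w → w ≢ v → column w ≤ 1
  column≤1 w w≢v = begin
    column w ≡⟨ sum-cong-≗ (λ e → sym (χ-∧ (incident H e v) (incident H e w))) ⟩
    ∑[ e < nE H ] χ (incident H e v ∧ incident H e w)
             ≤⟨ count≤1 (λ e → incident H e v ∧ incident H e w) unique ⟩
    1        ∎
    where
    unique : ∀ e f → incident H e v ∧ incident H e w ≡ true
           → incident H f v ∧ incident H f w ≡ true → e ≡ f
    unique e f e∋vw f∋vw = common-edge-unique H lin (λ v≡w → w≢v (sym v≡w)) e f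
      (∧-conicalˡ _ _ e∋vw) (∧-conicalʳ _ _ e∋vw) (∧-conicalˡ _ _ f∋vw) (∧-conicalʳ _ _ f∋vw)

uniform-rank : (H : Hypergraph) {P : ℕ} → Uniform H → ∃ (λ e → rank H e ≡ P) → ∀ e → rank H e ≡ P
uniform-rank H uni (e₀ , rank-e₀) e = trans (uni e e₀) rank-e₀

uniform-star-sum : (H : Hypergraph) (P : ℕ) → (∀ e → rank H e ≡ P) → (v : Fin (nV H))
  → ∑[ e < nE H ] (χ (incident H e v) * rank H e) ≡ degree H v * P
uniform-star-sum H P rank≡P v = begin
  ∑[ e < nE H ] (χ (incident H e v) * rank H e)
    ≡⟨ sum-cong-≗ (λ e → cong (χ (incident H e v) *_) (rank≡P e)) ⟩
  ∑[ e < nE H ] (χ (incident H e v) * P)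
    ≡⟨ sym (*-distribʳ-sum P (λ e → χ (incident H e v))) ⟩
  (∑[ e < nE H ] χ (incident H e v)) * P
    ≡⟨ cong (_* P) (sym (degree≡∑ H v)) ⟩
  degree H v * P ∎
  where open ≡-Reasoning

-- In a linear hypergraph whose edges all have rank P, the edges through a
-- vertex v cover 1 + deg v · (P − 1) distinct vertices, so
-- deg v · (P − 1) ≤ n − 1.
uniform-degree-bound : (H : Hypergraph) (P : ℕ) → Linear H → (∀ e → rank H e ≡ P)
  → (v : Fin (nV H)) → degree H v * (P ∸ 1) ≤ nV H ∸ 1
uniform-degree-bound H P lin rank≡P v = begin
  d * (P ∸ 1) ≡⟨ trans (*-distribˡ-∸ d P 1) (cong (d * P ∸_) (*-identityʳ d)) ⟩
  d * P ∸ d   ≤⟨ m≤n+o⇒m∸n≤o (d * P) d d*P≤d+n-1 ⟩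
  nV H ∸ 1    ∎
  where
  open ≤-Reasoning
  d : ℕ
  d = degree H v
  d*P≤d+n-1 : d * P ≤ d + (nV H ∸ 1)
  d*P≤d+n-1 = ≤-trans (≤-reflexive (sym (uniform-star-sum H P rank≡P v))) (star-bound H lin v)

colours-mono : (H : Hypergraph) {k m : ℕ} → k ≤ m → ChromaticIndex≤ H k → ChromaticIndex≤ H m
colours-mono H k≤m (γ , proper) =
  (λ e → inject≤ (γ e) k≤m) ,
  (λ e f e≢f same → proper e f e≢f (inject≤-injective k≤m k≤m (γ e) (γ f) same))

corollary6 : (C : ℕ) → 3 ≤ C
    → ((H' : Hypergraph) (P' Δ' : ℕ) → Linear H' → NoRankOne H'
        → MaxRank H' P' → C ≤ P' → MaxDegree H' Δ' → C * (P' ∸ 1) ≤ Δ'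
        → ChromaticIndex≤ H' (Δ' * (P' ∸ 1) ∸ 1))
    → (H : Hypergraph) (P Δ : ℕ) → Linear H → NoRankOne H
    → MaxRank H P → C ≤ P → MaxDegree H Δ → C * (P ∸ 1) ≤ Δ
    → (Uniform H ⊎ Δ * (P ∸ 1) ∸ 1 ≤ nV H)
    → ChromaticIndex≤ H (nV H)
corollary6 C _ q-bound H P Δ lin no-rank-1 max-rank C≤P max-degree C[P-1]≤Δ uniform-or-large =
  colours-mono H enough-vertices (q-bound H P Δ lin no-rank-1 max-rank C≤P max-degree C[P-1]≤Δ)
  where
  uniform-case : ∃ (λ v → degree H v ≡ Δ) → Uniform H → Δ * (P ∸ 1) ∸ 1 ≤ nV H
  uniform-case (v , deg-v≡Δ) uni = begin
    Δ * (P ∸ 1) ∸ 1        ≤⟨ m∸n≤m (Δ * (P ∸ 1)) 1 ⟩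
    Δ * (P ∸ 1)            ≡⟨ cong (_* (P ∸ 1)) (sym deg-v≡Δ) ⟩
    degree H v * (P ∸ 1)   ≤⟨ uniform-degree-bound H P lin (uniform-rank H uni (proj₂ max-rank)) v ⟩
    nV H ∸ 1               ≤⟨ m∸n≤m (nV H) 1 ⟩
    nV H                   ∎
    where open ≤-Reasoning
  enough-vertices : Δ * (P ∸ 1) ∸ 1 ≤ nV H
  enough-vertices = [ uniform-case (proj₂ max-degree) , id ] uniform-or-large
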